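{- Let $P_n$ be the path on $n$ vertices and $k$ a positive integer with $k\ge\chi(P_n)$ and $n\ge k+1$. Then the strong $k$-colour graph $S_k(P_n)$ is connected if and only if $k\ge 3$, $n\ge 5$ and $n\ge k+1$.
   Context: A proper $k$-colouring of a graph $G$ is a map $V(G)\to\{1,\dots,k\}$ giving adjacent vertices different colours; it is strong if all $k$ colours appear. The strong $k$-colour graph $S_k(G)$ has the strong $k$-colourings of $G$ as vertices, two being adjacent iff they differ in colour on exactly one vertex of $G$. -}

module Defs where

open import Data.Nat using (ℕ; suc; _≤_)
open import Data.Fin using (Fin; toℕ)
open import Data.Product using (Σ; ∃; _×_; _,_)
open import Data.Sum using (_⊎_)
open import Relation.Nullary using (¬_)
open import Relation.Binary.PropositionalEquality using (_≡_; _≢_)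
open import Relation.Binary.Construct.Closure.ReflexiveTransitive using (Star)

Graph : ℕ → Set₁
Graph n = Fin n → Fin n → Set

Path : (n : ℕ) → Graph n
Path n i j = toℕ j ≡ suc (toℕ i) ⊎ toℕ i ≡ suc (toℕ j)

-- A colouring with colours Fin k (standing for {1,…,k}).
Colouring : ℕ → ℕ → Set
Colouring n k = Fin n → Fin k

Proper : {n : ℕ} → Graph n → (k : ℕ) → Colouring n k → Set
Proper G k c = ∀ u v → G u v → c u ≢ c v

Surjective : {n k : ℕ} → Colouring n k → Set
Surjective {n} {k} c = ∀ (a : Fin k) → ∃ λ v → c v ≡ a

Strong : {n : ℕ} → Graph n → (k : ℕ) → Colouring n k → Set
Strong G k c = Proper G k c × Surjective c

Colourable : {n : ℕ} → Graph n → ℕ → Set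
Colourable G k = ∃ λ (c : Colouring _ k) → Proper G k c

IsChromaticNumber : {n : ℕ} → Graph n → ℕ → Set
IsChromaticNumber G χ = Colourable G χ × (∀ m → Colourable G m → χ ≤ m)

SVertex : {n : ℕ} → Graph n → ℕ → Set
SVertex {n} G k = Σ (Colouring n k) (Strong G k)

SAdj : {n : ℕ} → (G : Graph n) → (k : ℕ) → SVertex G k → SVertex G k → Set
SAdj {n} G k (c , _) (d , _) =
  ∃ λ (v : Fin n) → c v ≢ d v × (∀ w → w ≢ v → c w ≡ d w)

SConnected : {n : ℕ} → Graph n → ℕ → Set
SConnected G k = ∀ (x y : SVertex G k) → Star (SAdj G k) x y

-- With one colour P_n (n ≥ 2) has no proper colouring. With two colours no vertex can be
-- recoloured, since a neighbour already excludes the other colour, so S_2(P_n) has no edges but at least two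
-- vertices. In S_3(P_4) the colour of vertex 1 never changes.
--
-- Sufficiency, by induction on n, from n = 5 (k = 3, 4), where connectivity is checked by computation against
-- a breadth-first certificate. With k ≥ 4 colours every strong colouring of P_{n+1} is joined, by recolouring
-- the other vertices of the last vertex's colour x, to one in which x is unique; such colourings are strong
-- (k-1)-colourings of P_n followed by a fresh colour, hence connected by induction, and x is changed once,
-- through a colouring in which it is repeated. With k = 3 every colouring is first joined to one whose first
-- n vertices use all three colours, and then walks of S_3(P_n) lift to S_3(P_{n+1}), moving the last vertex
-- out of the way where needed.

module Submission where

open import Defs
open import Data.Empty using (⊥; ⊥-elim)
open import Data.Fin as Fin using (Fin; zero; suc; toℕ; fromℕ<; punchIn; punchOut)
open import Data.Fin.Properties as Finₚ
  using ( _≟_; all?; any?; ¬∀⟶∃¬; pigeonhole; toℕ-injective; toℕ<n; toℕ-fromℕ<; toℕ-inject₁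
        ; punchInᵢ≢i; punchIn-injective; punchIn-punchOut; punchOut-punchIn; punchOut-cong )
import Data.List as List
open import Data.List using (List; []; _∷_; length)
open import Data.List.Membership.Propositional using (_∈_; _∉_)
open import Data.List.Relation.Unary.All as All using (All; []; _∷_; lookupAny)
open import Data.List.Relation.Unary.Any as Any using (here; there; index)
open import Data.List.Relation.Unary.Any.Properties using (lookup-index)
open import Data.Nat as ℕ using (ℕ; zero; suc; pred; _+_; _≤_; _<_; z≤n; s≤s; NonZero)
import Data.Nat.Properties as ℕₚ
open import Data.Nat.DivMod using (_%_; _mod_; m<n⇒m%n≡m; n%n≡0; %-distribˡ-+; m%n<n)
open import Data.Product using (Σ; ∃; ∃₂; _×_; _,_; proj₁; proj₂; map₂)
open import Data.Sum as Sum using (_⊎_; inj₁; inj₂)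
open import Data.Unit using (⊤)
open import Data.Vec as Vec using (Vec; []; _∷_; lookup; tabulate)
open import Data.Vec.Properties using (≡-dec; lookup∘tabulate)
open import Function using (_∘_)
open import Function.Bundles using (_⇔_; mk⇔)
open import Relation.Binary.Construct.Closure.ReflexiveTransitive using (Star; ε; _◅_; _◅◅_; gmap; reverse)
open import Relation.Binary.Construct.Union using (_∪_)
open import Relation.Binary.PropositionalEquality
open import Relation.Nullary using (¬_; Dec; yes; no; ¬?)
open import Relation.Nullary.Decidable using (True; toWitness; _×-dec_; _⊎-dec_; _→-dec_; map′; from-yes)

opaque
  fresh : ∀ {k} (xs : List (Fin k)) → length xs < k → ∃ λ z → z ∉ xs
  fresh {k} xs |xs|<k = ¬∀⟶∃¬ k (_∈ xs) (λ z → Any.any? (z ≟_) xs) not-all-listed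
    where
    not-all-listed : ¬ (∀ z → z ∈ xs)
    not-all-listed listed with pigeonhole |xs|<k (λ z → index (listed z))
    ... | i , j , i<j , same-index = Finₚ.<⇒≢ i<j (begin
      i                                 ≡⟨ lookup-index (listed i) ⟩
      List.lookup xs (index (listed i)) ≡⟨ cong (List.lookup xs) same-index ⟩
      List.lookup xs (index (listed j)) ≡⟨ lookup-index (listed j) ⟨
      j                                 ∎)
      where open ≡-Reasoning

fresh₂ : ∀ {k} → 3 ≤ k → (a b : Fin k) → ∃ λ z → z ≢ a × z ≢ b
fresh₂ 3≤k a b with fresh (a ∷ b ∷ []) 3≤k
... | z , z∉ = z , z∉ ∘ here , z∉ ∘ there ∘ here

fresh₃ : ∀ {k} → 4 ≤ k → (a b c : Fin k) → ∃ λ z → z ≢ a × z ≢ b × z ≢ c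
fresh₃ 4≤k a b c with fresh (a ∷ b ∷ c ∷ []) 4≤k
... | z , z∉ = z , z∉ ∘ here , z∉ ∘ there ∘ here , z∉ ∘ there ∘ there ∘ here

avoiding-one-unique₂ : (x a b : Fin 2) → a ≢ x → b ≢ x → a ≡ b
avoiding-one-unique₂ = from-yes decision
  where
  decision : Dec ((x a b : Fin 2) → a ≢ x → b ≢ x → a ≡ b)
  decision = all? λ x → all? λ a → all? λ b → ¬? (a ≟ x) →-dec ¬? (b ≟ x) →-dec a ≟ b

avoiding-two-unique₃ : (x y a b : Fin 3) → x ≢ y → a ≢ x → a ≢ y → b ≢ x → b ≢ y → a ≡ b
avoiding-two-unique₃ = from-yes decision
  where
  decision : Dec ((x y a b : Fin 3) → x ≢ y → a ≢ x → a ≢ y → b ≢ x → b ≢ y → a ≡ b)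
  decision = all? λ x → all? λ y → all? λ a → all? λ b →
    ¬? (x ≟ y) →-dec ¬? (a ≟ x) →-dec ¬? (a ≟ y) →-dec ¬? (b ≟ x) →-dec ¬? (b ≟ y) →-dec a ≟ b

-- Colourings of the path on the vertices 0, …, n-1; the values of colour at i ≥ n are irrelevant.
record PathColouring (n k : ℕ) : Set where
  field
    colour : ℕ → Fin k
    proper : ∀ i → suc i < n → colour i ≢ colour (suc i)
    covers : ∀ a → ∃ λ i → i < n × colour i ≡ a
open PathColouring public

module _ {n k : ℕ} where

  infix 4 _≈_ _⇝_

  record _≈_ (c d : PathColouring n k) : Set where
    constructor agreeing
    field agree : ∀ i → i < n → colour c i ≡ colour d i
  open _≈_ public

  record Adjacent (c d : PathColouring n k) : Set where
    constructor adjacent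
    field
      vertex     : ℕ
      vertex<n   : vertex < n
      recoloured : colour c vertex ≢ colour d vertex
      unchanged  : ∀ w → w < n → w ≢ vertex → colour c w ≡ colour d w

  -- Walks in S_k(P_n) are taken up to agreement on the vertices, as colourings are compared pointwise.
  _⇝_ : (c d : PathColouring n k) → Set
  _⇝_ = Star (Adjacent ∪ _≈_)

  ≈-sym : ∀ {c d} → c ≈ d → d ≈ c
  ≈-sym c≈d = agreeing λ i i<n → sym (agree c≈d i i<n)

  Adjacent-sym : ∀ {c d} → Adjacent c d → Adjacent d c
  Adjacent-sym (adjacent v v<n differ same) =
    adjacent v v<n (differ ∘ sym) λ w w<n w≢v → sym (same w w<n w≢v)

  step-sym : ∀ {c d} → (Adjacent ∪ _≈_) c d → (Adjacent ∪ _≈_) d c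
  step-sym (inj₁ c~d) = inj₁ (Adjacent-sym c~d)
  step-sym (inj₂ c≈d) = inj₂ (≈-sym c≈d)

  ⇝-sym : ∀ {c d} → c ⇝ d → d ⇝ c
  ⇝-sym = reverse step-sym

  ≈⇒⇝ : ∀ {c d} → c ≈ d → c ⇝ d
  ≈⇒⇝ c≈d = inj₂ c≈d ◅ ε

  Adjacent⇒⇝ : ∀ {c d} → Adjacent c d → c ⇝ d
  Adjacent⇒⇝ c~d = inj₁ c~d ◅ ε

Connected : ℕ → ℕ → Set
Connected n k = (c d : PathColouring n k) → c ⇝ d

opaque
  _[_≔_] : {A : Set} → (ℕ → A) → ℕ → A → ℕ → A
  (g [ v ≔ a ]) i with i ℕ.≟ v
  ... | yes _ = a
  ... | no  _ = g i

  [≔]-updated : {A : Set} (g : ℕ → A) (v : ℕ) (a : A) → (g [ v ≔ a ]) v ≡ a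
  [≔]-updated g v a with v ℕ.≟ v
  ... | yes _   = refl
  ... | no  v≢v = ⊥-elim (v≢v refl)

  [≔]-unchanged : {A : Set} (g : ℕ → A) {v : ℕ} (a : A) {i : ℕ} → i ≢ v → (g [ v ≔ a ]) i ≡ g i
  [≔]-unchanged g {v} a {i} i≢v with i ℕ.≟ v
  ... | yes i≡v = ⊥-elim (i≢v i≡v)
  ... | no  _   = refl

pred<self : ∀ {v} → v ≢ 0 → pred v < v
pred<self {zero}  0≢0 = ⊥-elim (0≢0 refl)
pred<self {suc v} _   = ℕₚ.n<1+n v

proper-pred : ∀ {n k} (c : PathColouring n k) {v} → v ≢ 0 → v < n → colour c (pred v) ≢ colour c v
proper-pred c {zero}  0≢0 _   = ⊥-elim (0≢0 refl)
proper-pred c {suc v} _   v<n = proper c v v<n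

module _ {n k : ℕ} (c : PathColouring n k) (v : ℕ) (a : Fin k) where

  record Recolourable : Set where
    field
      left   : v ≢ 0 → colour c (pred v) ≢ a
      right  : suc v < n → a ≢ colour c (suc v)
      covers : ∀ b → ∃ λ i → i < n × (colour c [ v ≔ a ]) i ≡ b

  recolour : Recolourable → PathColouring n k
  recolour h = record { colour = colour c [ v ≔ a ] ; proper = proper′ ; covers = Recolourable.covers h }
    where
    open Recolourable h using (left; right)
    updated : (colour c [ v ≔ a ]) v ≡ a
    updated = [≔]-updated (colour c) v a
    unchanged : ∀ {i} → i ≢ v → (colour c [ v ≔ a ]) i ≡ colour c i
    unchanged = [≔]-unchanged (colour c) a
    proper′ : ∀ i → suc i < n → (colour c [ v ≔ a ]) i ≢ (colour c [ v ≔ a ]) (suc i)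
    proper′ i i+1<n with i ℕ.≟ v | suc i ℕ.≟ v
    ... | yes refl | yes i+1≡i = ⊥-elim (ℕₚ.1+n≢n i+1≡i)
    ... | yes refl | no  i+1≢i = λ eq → right i+1<n (trans (sym updated) (trans eq (unchanged i+1≢i)))
    ... | no  i≢v  | yes refl  = λ eq → left (λ ()) (trans (sym (unchanged i≢v)) (trans eq updated))
    ... | no  i≢v  | no  i+1≢v = λ eq → proper c i i+1<n (trans (sym (unchanged i≢v)) (trans eq (unchanged i+1≢v)))

  recolour-adjacent : (h : Recolourable) → v < n → a ≢ colour c v → Adjacent c (recolour h)
  recolour-adjacent h v<n a≢cv =
    adjacent v v<n (λ eq → a≢cv (sym (trans eq ([≔]-updated (colour c) v a))))
      λ w _ w≢v → sym ([≔]-unchanged (colour c) a w≢v)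

  covers-if-covered-elsewhere : (∀ b → ∃ λ i → i < n × i ≢ v × colour c i ≡ b)
                              → ∀ b → ∃ λ i → i < n × (colour c [ v ≔ a ]) i ≡ b
  covers-if-covered-elsewhere elsewhere b with elsewhere b
  ... | i , i<n , i≢v , ci≡b = i , i<n , trans ([≔]-unchanged (colour c) a i≢v) ci≡b

  covered-elsewhere-if-repeated : ∀ {w} → w < n → w ≢ v → colour c w ≡ colour c v
                                → ∀ b → ∃ λ i → i < n × i ≢ v × colour c i ≡ b
  covered-elsewhere-if-repeated {w} w<n w≢v cw≡cv b with covers c b
  ... | i , i<n , ci≡b with i ℕ.≟ v
  ...   | no  i≢v = i , i<n , i≢v , ci≡b
  ...   | yes refl = w , w<n , w≢v , trans cw≡cv ci≡b

covers-if-agrees : ∀ {m n k} {g : ℕ → Fin k} (r : PathColouring m k) → m ≤ n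
                 → (∀ i → i < m → g i ≡ colour r i) → ∀ b → ∃ λ i → i < n × g i ≡ b
covers-if-agrees r m≤n agree b with covers r b
... | i , i<m , ri≡b = i , ℕₚ.<-≤-trans i<m m≤n , trans (agree i i<m) ri≡b

toℕ-mod : ∀ i n .{{_ : NonZero n}} → toℕ (i mod n) ≡ i % n
toℕ-mod i n = toℕ-fromℕ< _

toℕ-mod-< : ∀ {i n} .{{_ : NonZero n}} → i < n → toℕ (i mod n) ≡ i
toℕ-mod-< {i} {n} i<n = trans (toℕ-mod i n) (m<n⇒m%n≡m i<n)

toℕ-mod-inverse : ∀ {n} .{{_ : NonZero n}} (a : Fin n) → toℕ a mod n ≡ a
toℕ-mod-inverse a = toℕ-injective (toℕ-mod-< (toℕ<n a))

module _ {k : ℕ} (1≤k : 1 ≤ k) where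

  private
    K : ℕ
    K = suc k

  %-suc : ∀ i → suc i % K ≡ suc (i % K) % K
  %-suc i = begin
    suc i % K           ≡⟨ %-distribˡ-+ 1 i K ⟩
    (1 % K + i % K) % K ≡⟨ cong (λ t → (t + i % K) % K) (m<n⇒m%n≡m (s≤s 1≤k)) ⟩
    suc (i % K) % K     ∎
    where open ≡-Reasoning

  mod-suc-≢ : ∀ i → i mod K ≢ suc i mod K
  mod-suc-≢ i eq = impossible (ℕₚ.m≤n⇒m<n∨m≡n (m%n<n i K))
    where
    r≡r+1 : i % K ≡ suc (i % K) % K
    r≡r+1 = trans (sym (toℕ-mod i K)) (trans (cong toℕ eq) (trans (toℕ-mod (suc i) K) (%-suc i)))
    impossible : suc (i % K) < K ⊎ suc (i % K) ≡ K → ⊥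
    impossible (inj₁ r+1<K) = ℕₚ.1+n≢n (sym (trans r≡r+1 (m<n⇒m%n≡m r+1<K)))
    impossible (inj₂ r+1≡K) = ℕₚ.n≮0 (subst (1 ≤_) k≡0 1≤k)
      where
      r≡0 : i % K ≡ 0
      r≡0 = trans r≡r+1 (trans (cong (_% K) r+1≡K) (n%n≡0 K))
      k≡0 : k ≡ 0
      k≡0 = cong pred (trans (sym r+1≡K) (cong suc r≡0))

module _ {n k : ℕ} (1≤k : 1 ≤ k) (k<n : k < n) where

  cyclic : PathColouring n (suc k)
  cyclic = record
    { colour = _mod suc k
    ; proper = λ i _ → mod-suc-≢ 1≤k i
    ; covers = λ a → toℕ a , ℕₚ.<-≤-trans (toℕ<n a) k<n , toℕ-mod-inverse a
    }

  shifted : PathColouring n (suc k)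
  shifted = record
    { colour = λ i → suc i mod suc k
    ; proper = λ i _ → mod-suc-≢ 1≤k (suc i)
    ; covers = covers′
    }
    where
    covers′ : ∀ a → ∃ λ i → i < n × suc i mod suc k ≡ a
    covers′ zero    = k , k<n , toℕ-injective (trans (toℕ-mod (suc k) (suc k)) (n%n≡0 (suc k)))
    covers′ (suc a) = toℕ a , ℕₚ.<-trans (toℕ<n a) k<n
                    , toℕ-injective (toℕ-mod-< (s≤s (toℕ<n a)))

  cyclic-repeats : colour cyclic (suc k) ≡ colour cyclic 0
  cyclic-repeats = toℕ-injective (trans (toℕ-mod (suc k) (suc k)) (n%n≡0 (suc k)))

-- Adding a vertex and a colour

punchIn-inject₁-or-suc : ∀ {k} (x : Fin (suc k)) (b : Fin k) → punchIn x b ≡ Fin.inject₁ b ⊎ punchIn x b ≡ suc b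
punchIn-inject₁-or-suc zero    b       = inj₂ refl
punchIn-inject₁-or-suc (suc x) zero    = inj₁ refl
punchIn-inject₁-or-suc (suc x) (suc b) = Sum.map (cong suc) (cong suc) (punchIn-inject₁-or-suc x b)

-- Inverse of punchIn x on the colours other than x; squash x x is junk.
squash : ∀ {k} → Fin (suc (suc k)) → Fin (suc (suc k)) → Fin (suc k)
squash x y with x ≟ y
... | yes _   = zero
... | no  x≢y = punchOut x≢y

punchIn-squash : ∀ {k} {x y : Fin (suc (suc k))} → y ≢ x → punchIn x (squash x y) ≡ y
punchIn-squash {x = x} {y} y≢x with x ≟ y
... | yes x≡y = ⊥-elim (y≢x (sym x≡y))
... | no  x≢y = punchIn-punchOut x≢y

squash-punchIn : ∀ {k} (x : Fin (suc (suc k))) (b : Fin (suc k)) → squash x (punchIn x b) ≡ b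
squash-punchIn x b with x ≟ punchIn x b
... | yes x≡x′ = ⊥-elim (punchInᵢ≢i x b (sym x≡x′))
... | no  x≢x′ = trans (punchOut-cong x refl) (punchOut-punchIn x)

module _ {m k : ℕ} where

  extend : Fin (suc k) → PathColouring m k → PathColouring (suc m) (suc k)
  extend x r = record { colour = g ; proper = proper′ ; covers = covers′ }
    where
    g : ℕ → Fin (suc k)
    g = (punchIn x ∘ colour r) [ m ≔ x ]
    proper′ : ∀ i → suc i < suc m → g i ≢ g (suc i)
    proper′ i (s≤s i+1≤m) with suc i ℕ.≟ m
    ... | yes refl = λ eq → punchInᵢ≢i x (colour r i)
                       (trans (sym ([≔]-unchanged _ x (ℕₚ.1+n≢n ∘ sym))) (trans eq ([≔]-updated _ m x)))
    ... | no i+1≢m = λ eq → proper r i i+1<m (punchIn-injective x _ _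
                       (trans (sym ([≔]-unchanged _ x i≢m)) (trans eq ([≔]-unchanged _ x i+1≢m))))
      where
      i+1<m : suc i < m
      i+1<m = ℕₚ.≤∧≢⇒< i+1≤m i+1≢m
      i≢m : i ≢ m
      i≢m = ℕₚ.<⇒≢ (ℕₚ.<-trans (ℕₚ.n<1+n i) i+1<m)
    covers′ : ∀ a → ∃ λ i → i < suc m × g i ≡ a
    covers′ a with x ≟ a
    ... | yes refl = m , ℕₚ.n<1+n m , [≔]-updated _ m x
    ... | no  x≢a with covers r (punchOut x≢a)
    ...   | i , i<m , ri≡a′ = i , ℕₚ.<-trans i<m (ℕₚ.n<1+n m)
            , trans ([≔]-unchanged _ x (ℕₚ.<⇒≢ i<m)) (trans (cong (punchIn x) ri≡a′) (punchIn-punchOut x≢a))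

  extend-last : ∀ x r → colour (extend x r) m ≡ x
  extend-last x r = [≔]-updated _ m x

  extend-below : ∀ x r {i} → i < m → colour (extend x r) i ≡ punchIn x (colour r i)
  extend-below x r i<m = [≔]-unchanged _ x (ℕₚ.<⇒≢ i<m)

  extend-cong : ∀ x {r r′ : PathColouring m k} {i} → i < suc m → (i < m → colour r i ≡ colour r′ i)
              → colour (extend x r) i ≡ colour (extend x r′) i
  extend-cong x {r} {r′} i<m+1 same with ℕₚ.m<1+n⇒m<n∨m≡n i<m+1
  ... | inj₁ i<m  = trans (extend-below x r i<m) (trans (cong (punchIn x) (same i<m)) (sym (extend-below x r′ i<m)))
  ... | inj₂ refl = trans (extend-last x r) (sym (extend-last x r′))

  extend-≈ : ∀ x {r r′ : PathColouring m k} → r ≈ r′ → extend x r ≈ extend x r′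
  extend-≈ x {r} {r′} r≈r′ = agreeing λ i i<m+1 → extend-cong x {r} {r′} i<m+1 (agree r≈r′ i)

  extend-adjacent : ∀ x {r r′ : PathColouring m k} → Adjacent r r′ → Adjacent (extend x r) (extend x r′)
  extend-adjacent x {r} {r′} (adjacent v v<m differ same) =
    adjacent v (ℕₚ.<-trans v<m (ℕₚ.n<1+n m))
      (λ eq → differ (punchIn-injective x _ _ (trans (sym (extend-below x r v<m)) (trans eq (extend-below x r′ v<m)))))
      λ w w<m+1 w≢v → extend-cong x {r} {r′} w<m+1 λ w<m → same w w<m w≢v

  extend-⇝ : ∀ x {r r′ : PathColouring m k} → r ⇝ r′ → extend x r ⇝ extend x r′
  extend-⇝ x = gmap (extend x) (Sum.map (extend-adjacent x) (extend-≈ x))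

module _ {m k : ℕ} where

  extract : (c : PathColouring (suc m) (suc (suc k))) → (∀ j → j < m → colour c j ≢ colour c m)
          → ∃ λ (r : PathColouring m (suc k)) → c ≈ extend (colour c m) r
  extract c fresh-last = r , agreeing agree′
    where
    x : Fin (suc (suc k))
    x = colour c m
    r : PathColouring m (suc k)
    r = record { colour = squash x ∘ colour c ; proper = proper′ ; covers = covers′ }
      where
      proper′ : ∀ i → suc i < m → squash x (colour c i) ≢ squash x (colour c (suc i))
      proper′ i i+1<m eq = proper c i (ℕₚ.<-trans i+1<m (ℕₚ.n<1+n m)) (begin
        colour c i                        ≡⟨ punchIn-squash (fresh-last i (ℕₚ.<-trans (ℕₚ.n<1+n i) i+1<m)) ⟨
        punchIn x (squash x (colour c i)) ≡⟨ cong (punchIn x) eq ⟩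
        punchIn x (squash x (colour c (suc i))) ≡⟨ punchIn-squash (fresh-last (suc i) i+1<m) ⟩
        colour c (suc i)                  ∎)
        where open ≡-Reasoning
      covers′ : ∀ b → ∃ λ i → i < m × squash x (colour c i) ≡ b
      covers′ b with covers c (punchIn x b)
      ... | i , i<m+1 , ci≡b′ with ℕₚ.m<1+n⇒m<n∨m≡n i<m+1
      ...   | inj₁ i<m  = i , i<m , trans (cong (squash x) ci≡b′) (squash-punchIn x b)
      ...   | inj₂ refl = ⊥-elim (punchInᵢ≢i x b (sym ci≡b′))
    agree′ : ∀ i → i < suc m → colour c i ≡ colour (extend x r) i
    agree′ i i<m+1 with ℕₚ.m<1+n⇒m<n∨m≡n i<m+1
    ... | inj₁ i<m  = trans (sym (punchIn-squash (fresh-last i i<m))) (sym (extend-below x r i<m))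
    ... | inj₂ refl = sym (extend-last x r)

module _ {m k : ℕ} (4≤k : 4 ≤ k) where

  recolour-away : (c : PathColouring (suc m) k) → ∀ {i} → i < m → colour c i ≡ colour c m
    → ∃ λ c′ → Adjacent c c′ × colour c′ i ≢ colour c m × (∀ j → j ≢ i → colour c′ j ≡ colour c j)
  recolour-away c {i} i<m ci≡x with fresh₃ 4≤k (colour c (pred i)) (colour c (suc i)) (colour c m)
  ... | z , z≢left , z≢right , z≢x =
    c′ , recolour-adjacent c i z h (ℕₚ.<-trans i<m (ℕₚ.n<1+n m)) (λ eq → z≢x (trans eq ci≡x))
      , (λ eq → z≢x (trans (sym ([≔]-updated (colour c) i z)) eq))
      , λ j j≢i → [≔]-unchanged (colour c) z j≢i
    where
    h : Recolourable c i z
    h = record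
      { left   = λ _ → z≢left ∘ sym
      ; right  = λ _ → z≢right
      ; covers = covers-if-covered-elsewhere c i z
                   (covered-elsewhere-if-repeated c i z (ℕₚ.n<1+n m) (ℕₚ.<⇒≢ i<m ∘ sym) (sym ci≡x))
      }
    c′ : PathColouring (suc m) k
    c′ = recolour c i z h

  clear-below : ∀ i → i ≤ m → (c : PathColouring (suc m) k)
              → ∃ λ c′ → c ⇝ c′ × colour c′ m ≡ colour c m × (∀ j → j < i → colour c′ j ≢ colour c′ m)
  clear-below zero    _   c = c , ε , refl , λ _ ()
  clear-below (suc i) i<m c with clear-below i (ℕₚ.<⇒≤ i<m) c
  ... | c₁ , c⇝c₁ , same-last₁ , cleared₁ with colour c₁ i ≟ colour c₁ m
  ...   | no  c₁i≢x = c₁ , c⇝c₁ , same-last₁ , cleared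
    where
    cleared : ∀ j → j < suc i → colour c₁ j ≢ colour c₁ m
    cleared j j<i+1 with ℕₚ.m<1+n⇒m<n∨m≡n j<i+1
    ... | inj₁ j<i  = cleared₁ j j<i
    ... | inj₂ refl = c₁i≢x
  ...   | yes c₁i≡x with recolour-away c₁ i<m c₁i≡x
  ...     | c₂ , c₁~c₂ , c₂i≢x , unchanged =
    c₂ , c⇝c₁ ◅◅ Adjacent⇒⇝ c₁~c₂ , trans same-last₂ same-last₁ , cleared
    where
    same-last₂ : colour c₂ m ≡ colour c₁ m
    same-last₂ = unchanged m (ℕₚ.<⇒≢ i<m ∘ sym)
    cleared : ∀ j → j < suc i → colour c₂ j ≢ colour c₂ m
    cleared j j<i+1 eq with ℕₚ.m<1+n⇒m<n∨m≡n j<i+1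
    ... | inj₁ j<i  = cleared₁ j j<i (trans (sym (unchanged j (ℕₚ.<⇒≢ j<i))) (trans eq same-last₂))
    ... | inj₂ refl = c₂i≢x (trans eq same-last₂)

module _ {m k : ℕ} (2≤k : 2 ≤ k) (k+1<m : suc k < m) (connected : Connected m (suc k)) where

  private
    1≤k : 1 ≤ k
    1≤k = ℕₚ.<⇒≤ 2≤k

  reach-extension : (c : PathColouring (suc m) (suc (suc k))) → ∃ λ r → c ⇝ extend (colour c m) r
  reach-extension c with clear-below (s≤s (s≤s 2≤k)) m ℕₚ.≤-refl c
  ... | c′ , c⇝c′ , same-last , cleared with extract c′ cleared
  ...   | r , c′≈ = r , c⇝c′ ◅◅ subst (λ x → c′ ⇝ extend x r) same-last (≈⇒⇝ c′≈)

  same-last-colour : ∀ c d → colour c m ≡ colour d m → c ⇝ d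
  same-last-colour c d eq with reach-extension c | reach-extension d
  ... | r , c⇝ | s , d⇝ =
    c⇝ ◅◅ extend-⇝ (colour c m) (connected r s) ◅◅ ⇝-sym (subst (λ x → d ⇝ extend x s) (sym eq) d⇝)

  base : PathColouring m (suc k)
  base = cyclic 1≤k (ℕₚ.<⇒≤ k+1<m)

  private
    hub-avoiding : ∃ λ z → z ≢ Fin.inject₁ (colour base (pred m)) × z ≢ suc (colour base (pred m))
    hub-avoiding = fresh₂ (s≤s (s≤s 1≤k)) _ _

  hub : Fin (suc (suc k))
  hub = proj₁ hub-avoiding

  hub-avoids : ∀ x → punchIn x (colour base (pred m)) ≢ hub
  hub-avoids x eq with punchIn-inject₁-or-suc x (colour base (pred m)) | proj₂ hub-avoiding
  ... | inj₁ eq₁ | hub≢₁ , _ = hub≢₁ (trans (sym eq) eq₁)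
  ... | inj₂ eq₂ | _ , hub≢₂ = hub≢₂ (trans (sym eq) eq₂)

  -- Give the last colour x a second occurrence at vertex 0, which frees vertex m to take the colour hub.
  last-colour-change : ∀ x → x ≢ hub → ∃₂ λ C D → C ⇝ D × colour C m ≡ x × colour D m ≡ hub
  last-colour-change x x≢hub =
    C , D , Adjacent⇒⇝ C~B ◅◅ Adjacent⇒⇝ B~D , extend-last x base , [≔]-updated (colour B) m hub
    where
    1<m : 1 < m
    1<m = ℕₚ.<-trans (s≤s 1≤k) k+1<m
    0<m : 0 < m
    0<m = ℕₚ.<-trans (s≤s z≤n) 1<m
    m≢0 : m ≢ 0
    m≢0 = ℕₚ.<⇒≢ 0<m ∘ sym
    m-1≢0 : pred m ≢ 0
    m-1≢0 eq = ℕₚ.n≮0 (subst (1 ≤_) eq (ℕₚ.suc[m]≤n⇒m≤pred[n] 1<m))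
    C : PathColouring (suc m) (suc (suc k))
    C = extend x base
    x≢C : ∀ {i} → i < m → x ≢ colour C i
    x≢C {i} i<m eq = punchInᵢ≢i x (colour base i) (sym (trans eq (extend-below x base i<m)))
    repeat : colour C (suc k) ≡ colour C 0
    repeat = trans (extend-below x base k+1<m)
               (trans (cong (punchIn x) (cyclic-repeats 1≤k (ℕₚ.<⇒≤ k+1<m))) (sym (extend-below x base 0<m)))
    h₁ : Recolourable C 0 x
    h₁ = record
      { left   = λ 0≢0 → ⊥-elim (0≢0 refl)
      ; right  = λ _ → x≢C 1<m
      ; covers = covers-if-covered-elsewhere C 0 x
                   (covered-elsewhere-if-repeated C 0 x (ℕₚ.<-trans k+1<m (ℕₚ.n<1+n m)) (λ ()) repeat)
      }
    B : PathColouring (suc m) (suc (suc k))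
    B = recolour C 0 x h₁
    C~B : Adjacent C B
    C~B = recolour-adjacent C 0 x h₁ (s≤s z≤n) (x≢C 0<m)
    B-last : colour B m ≡ x
    B-last = trans ([≔]-unchanged (colour C) x m≢0) (extend-last x base)
    h₂ : Recolourable B m hub
    h₂ = record
      { left   = λ _ eq → hub-avoids x (trans (sym (extend-below x base (pred<self m≢0)))
                   (trans (sym ([≔]-unchanged (colour C) x m-1≢0)) eq))
      ; right  = λ m+1<m+1 → ⊥-elim (ℕₚ.<-irrefl refl m+1<m+1)
      ; covers = covers-if-covered-elsewhere B m hub
                   (covered-elsewhere-if-repeated B m hub (s≤s z≤n) (ℕₚ.<⇒≢ 0<m)
                     (trans ([≔]-updated (colour C) 0 x) (sym B-last)))
      }
    D : PathColouring (suc m) (suc (suc k))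
    D = recolour B m hub h₂
    B~D : Adjacent B D
    B~D = recolour-adjacent B m hub h₂ (ℕₚ.n<1+n m) (λ eq → x≢hub (sym (trans eq B-last)))

  reach-hub : ∀ c → c ⇝ extend hub base
  reach-hub c with colour c m ≟ hub
  ... | yes cm≡hub = same-last-colour c _ (trans cm≡hub (sym (extend-last hub base)))
  ... | no  cm≢hub with last-colour-change (colour c m) cm≢hub
  ...   | C , D , C⇝D , Cm≡cm , Dm≡hub =
    same-last-colour c C (sym Cm≡cm) ◅◅ C⇝D ◅◅ same-last-colour D _ (trans Dm≡hub (sym (extend-last hub base)))

  extend-connected : Connected (suc m) (suc (suc k))
  extend-connected c d = reach-hub c ◅◅ ⇝-sym (reach-hub d)

-- Adding a vertex with the same colours

module _ {m k : ℕ} where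

  CoversBelow : PathColouring (suc m) k → Set
  CoversBelow c = ∀ a → ∃ λ i → i < m × colour c i ≡ a

  restrict : (c : PathColouring (suc m) k) → CoversBelow c → PathColouring m k
  restrict c h = record
    { colour = colour c
    ; proper = λ i i+1<m → proper c i (ℕₚ.<-trans i+1<m (ℕₚ.n<1+n m))
    ; covers = h
    }

  Extends : PathColouring (suc m) k → PathColouring m k → Set
  Extends C r = ∀ i → i < m → colour C i ≡ colour r i

  extends⇒⇝ : ∀ {C y : PathColouring (suc m) k} (hy : CoversBelow y) → Extends C (restrict y hy) → C ⇝ y
  extends⇒⇝ {C} {y} hy same with colour C m ≟ colour y m
  ... | yes Cm≡ym = ≈⇒⇝ (agreeing agree′)
    where
    agree′ : ∀ i → i < suc m → colour C i ≡ colour y i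
    agree′ i i<m+1 with ℕₚ.m<1+n⇒m<n∨m≡n i<m+1
    ... | inj₁ i<m  = same i i<m
    ... | inj₂ refl = Cm≡ym
  ... | no  Cm≢ym =
    Adjacent⇒⇝ (recolour-adjacent C m (colour y m) h (ℕₚ.n<1+n m) (Cm≢ym ∘ sym)) ◅◅ ≈⇒⇝ (agreeing agree′)
    where
    0<m : 0 < m
    0<m = ℕₚ.<-≤-trans (s≤s z≤n) (proj₁ (proj₂ (hy (colour y 0))))
    m≢0 : m ≢ 0
    m≢0 = ℕₚ.<⇒≢ 0<m ∘ sym
    h : Recolourable C m (colour y m)
    h = record
      { left   = λ _ eq → proper-pred y m≢0 (ℕₚ.n<1+n m) (trans (sym (same (pred m) (pred<self m≢0))) eq)
      ; right  = λ m+1<m+1 → ⊥-elim (ℕₚ.<-irrefl refl m+1<m+1)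
      ; covers = covers-if-agrees (restrict y hy) (ℕₚ.n≤1+n m)
                   λ i i<m → trans ([≔]-unchanged (colour C) _ (ℕₚ.<⇒≢ i<m)) (same i i<m)
      }
    agree′ : ∀ i → i < suc m → (colour C [ m ≔ colour y m ]) i ≡ colour y i
    agree′ i i<m+1 with ℕₚ.m<1+n⇒m<n∨m≡n i<m+1
    ... | inj₁ i<m  = trans ([≔]-unchanged (colour C) _ (ℕₚ.<⇒≢ i<m)) (same i i<m)
    ... | inj₂ refl = [≔]-updated (colour C) m (colour y m)

module _ {m k : ℕ} (3≤k : 3 ≤ k) where

  free-last : ∀ {r} (C : PathColouring (suc m) k) → Extends C r → (b : Fin k)
            → ∃ λ C′ → C ⇝ C′ × Extends C′ r × colour C′ m ≢ b
  free-last {r} C C⊒r b with colour C m ≟ b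
  ... | no  Cm≢b = C , ε , C⊒r , Cm≢b
  ... | yes Cm≡b with fresh₂ 3≤k (colour C (pred m)) b
  ...   | y , y≢left , y≢b =
    recolour C m y h , Adjacent⇒⇝ (recolour-adjacent C m y h (ℕₚ.n<1+n m) (λ eq → y≢b (trans eq Cm≡b)))
    , extends , λ eq → y≢b (trans (sym ([≔]-updated (colour C) m y)) eq)
    where
    extends : ∀ i → i < m → (colour C [ m ≔ y ]) i ≡ colour r i
    extends i i<m = trans ([≔]-unchanged (colour C) y (ℕₚ.<⇒≢ i<m)) (C⊒r i i<m)
    h : Recolourable C m y
    h = record
      { left   = λ _ → y≢left ∘ sym
      ; right  = λ m+1<m+1 → ⊥-elim (ℕₚ.<-irrefl refl m+1<m+1)
      ; covers = covers-if-agrees r (ℕₚ.n≤1+n m) extends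
      }

  lift-adjacent : ∀ {r r₁ : PathColouring m k} → Adjacent r r₁ → (C : PathColouring (suc m) k) → Extends C r
                → ∃ λ C′ → C ⇝ C′ × Extends C′ r₁
  lift-adjacent {r} {r₁} (adjacent v v<m differ same) C C⊒r with free-last {r} C C⊒r (colour r₁ v)
  ... | C₂ , C⇝C₂ , C₂⊒r , C₂m≢b =
    recolour C₂ v b h
    , C⇝C₂ ◅◅ Adjacent⇒⇝ (recolour-adjacent C₂ v b h (ℕₚ.<-trans v<m (ℕₚ.n<1+n m)) b≢C₂v)
    , extends
    where
    b : Fin k
    b = colour r₁ v
    b≢C₂v : b ≢ colour C₂ v
    b≢C₂v eq = differ (sym (trans eq (C₂⊒r v v<m)))
    C₂⊒r₁-off-v : ∀ i → i < m → i ≢ v → colour C₂ i ≡ colour r₁ i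
    C₂⊒r₁-off-v i i<m i≢v = trans (C₂⊒r i i<m) (same i i<m i≢v)
    extends : ∀ i → i < m → (colour C₂ [ v ≔ b ]) i ≡ colour r₁ i
    extends i i<m with i ℕ.≟ v
    ... | yes refl = [≔]-updated (colour C₂) v b
    ... | no  i≢v  = trans ([≔]-unchanged (colour C₂) b i≢v) (C₂⊒r₁-off-v i i<m i≢v)
    right : suc v < suc m → b ≢ colour C₂ (suc v)
    right (s≤s v+1≤m) with suc v ℕ.≟ m
    ... | yes refl = C₂m≢b ∘ sym
    ... | no  v+1≢m = λ eq → proper r₁ v v+1<m (trans eq (C₂⊒r₁-off-v (suc v) v+1<m ℕₚ.1+n≢n))
      where
      v+1<m : suc v < m
      v+1<m = ℕₚ.≤∧≢⇒< v+1≤m v+1≢m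
    h : Recolourable C₂ v b
    h = record
      { left   = λ v≢0 eq → proper-pred r₁ v≢0 v<m
                   (trans (sym (C₂⊒r₁-off-v (pred v) (ℕₚ.<-trans (pred<self v≢0) v<m) (ℕₚ.<⇒≢ (pred<self v≢0)))) eq)
      ; right  = right
      ; covers = covers-if-agrees r₁ (ℕₚ.n≤1+n m) extends
      }

  lift : ∀ {r r′ : PathColouring m k} → r ⇝ r′ → (C : PathColouring (suc m) k) → Extends C r
       → ∃ λ C′ → C ⇝ C′ × Extends C′ r′
  lift ε C C⊒r = C , ε , C⊒r
  lift (inj₁ r~r₁ ◅ r₁⇝r′) C C⊒r with lift-adjacent r~r₁ C C⊒r
  ... | C₁ , C⇝C₁ , C₁⊒r₁ with lift r₁⇝r′ C₁ C₁⊒r₁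
  ...   | C′ , C₁⇝C′ , C′⊒r′ = C′ , C⇝C₁ ◅◅ C₁⇝C′ , C′⊒r′
  lift (inj₂ r≈r₁ ◅ r₁⇝r′) C C⊒r = lift r₁⇝r′ C λ i i<m → trans (C⊒r i i<m) (agree r≈r₁ i i<m)

  lift-connected : Connected m k → (∀ c → ∃ λ c′ → c ⇝ c′ × CoversBelow c′) → Connected (suc m) k
  lift-connected connected normalise x y with normalise x | normalise y
  ... | x′ , x⇝x′ , hx | y′ , y⇝y′ , hy with lift (connected (restrict x′ hx) (restrict y′ hy)) x′ (λ _ _ → refl)
  ...   | C , x′⇝C , C⊒y′ = x⇝x′ ◅◅ x′⇝C ◅◅ extends⇒⇝ hy C⊒y′ ◅◅ ⇝-sym y⇝y′

-- With three colours, if the last colour x is missing below m then vertices 0 and 2 share the colour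
-- other than x and colour c 1, so vertex 0 can take the colour x.
covers-below-3 : ∀ {m} → 3 ≤ m → (c : PathColouring (suc m) 3) → ∃ λ c′ → c ⇝ c′ × CoversBelow c′
covers-below-3 {m} 3≤m c with any? (λ (j : Fin m) → colour c (toℕ j) ≟ colour c m)
... | yes (j , cj≡x) = c , ε , covers-below
  where
  covers-below : CoversBelow c
  covers-below a with covers c a
  ... | i , i<m+1 , ci≡a with ℕₚ.m<1+n⇒m<n∨m≡n i<m+1
  ...   | inj₁ i<m  = i , i<m , ci≡a
  ...   | inj₂ refl = toℕ j , toℕ<n j , trans cj≡x ci≡a
... | no x-absent = c′ , Adjacent⇒⇝ (recolour-adjacent c 0 x h (s≤s z≤n) (avoids 0 0<m ∘ sym)) , covers-below
  where
  x : Fin 3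
  x = colour c m
  2<m : 2 < m
  2<m = 3≤m
  1<m : 1 < m
  1<m = ℕₚ.<-trans (ℕₚ.n<1+n 1) 2<m
  0<m : 0 < m
  0<m = ℕₚ.<-trans (ℕₚ.n<1+n 0) 1<m
  <m+1 : ∀ {i} → i < m → i < suc m
  <m+1 i<m = ℕₚ.<-trans i<m (ℕₚ.n<1+n m)
  avoids : ∀ i → i < m → colour c i ≢ x
  avoids i i<m eq = x-absent (Fin.fromℕ< i<m , trans (cong (colour c) (toℕ-fromℕ< i<m)) eq)
  c₀≡c₂ : colour c 0 ≡ colour c 2
  c₀≡c₂ = avoiding-two-unique₃ x (colour c 1) (colour c 0) (colour c 2)
            (avoids 1 1<m ∘ sym) (avoids 0 0<m) (proper c 0 (<m+1 1<m)) (avoids 2 2<m) (proper c 1 (<m+1 2<m) ∘ sym)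
  h : Recolourable c 0 x
  h = record
    { left   = λ 0≢0 → ⊥-elim (0≢0 refl)
    ; right  = λ _ → avoids 1 1<m ∘ sym
    ; covers = covers-if-covered-elsewhere c 0 x (covered-elsewhere-if-repeated c 0 x (<m+1 2<m) (λ ()) (sym c₀≡c₂))
    }
  c′ : PathColouring (suc m) 3
  c′ = recolour c 0 x h
  covers-below : CoversBelow c′
  covers-below a with a ≟ x
  ... | yes refl = 0 , 0<m , [≔]-updated (colour c) 0 x
  ... | no  a≢x with covers c a
  ...   | i , i<m+1 , ci≡a with ℕₚ.m<1+n⇒m<n∨m≡n i<m+1
  ...     | inj₂ refl = ⊥-elim (a≢x (sym ci≡a))
  ...     | inj₁ i<m with i ℕ.≟ 0
  ...       | yes refl = 2 , 2<m , trans ([≔]-unchanged (colour c) x (λ ())) (trans (sym c₀≡c₂) ci≡a)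
  ...       | no  i≢0  = i , i<m , trans ([≔]-unchanged (colour c) x i≢0) ci≡a

module Walks {n : ℕ} (G : Graph n) (k : ℕ) where

  infix 4 _≐_

  record _≐_ (x y : SVertex G k) : Set where
    constructor pointwise
    field same : ∀ v → proj₁ x v ≡ proj₁ y v
  open _≐_ public

  data Step (x y : SVertex G k) : Set where
    adjacent : SAdj G k x y → Step x y
    equal    : x ≐ y → Step x y

  infix 4 _⇝ₛ_

  _⇝ₛ_ : (x y : SVertex G k) → Set
  _⇝ₛ_ = Star Step

  ≐-refl : ∀ {x} → x ≐ x
  ≐-refl = pointwise λ _ → refl

  ≐-trans : ∀ {x y z} → x ≐ y → y ≐ z → x ≐ z
  ≐-trans x≐y y≐z = pointwise λ v → trans (same x≐y v) (same y≐z v)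

  SAdj-respˡ : ∀ {x y z} → x ≐ y → SAdj G k y z → SAdj G k x z
  SAdj-respˡ x≐y (v , differ , agree) =
    v , (λ eq → differ (trans (sym (same x≐y v)) eq)) , λ w w≢v → trans (same x≐y w) (agree w w≢v)

  SAdj-respʳ : ∀ {x y z} → SAdj G k x y → y ≐ z → SAdj G k x z
  SAdj-respʳ (v , differ , agree) y≐z =
    v , (λ eq → differ (trans eq (sym (same y≐z v)))) , λ w w≢v → trans (agree w w≢v) (same y≐z w)

  -- Each ≐-step can be absorbed into a neighbouring edge, so only an empty walk is lost.
  exact-or-≐ : ∀ {x y} → x ⇝ₛ y → x ≐ y ⊎ Star (SAdj G k) x y
  exact-or-≐ ε = inj₁ ≐-refl
  exact-or-≐ {x} (_◅_ {j = x′} (adjacent x~x′) x′⇝y) with exact-or-≐ x′⇝y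
  ... | inj₁ x′≐y = inj₂ (SAdj-respʳ {x} {x′} x~x′ x′≐y ◅ ε)
  ... | inj₂ walk = inj₂ (x~x′ ◅ walk)
  exact-or-≐ (equal x≐x′ ◅ x′⇝y) with exact-or-≐ x′⇝y
  ... | inj₁ x′≐y          = inj₁ (≐-trans x≐x′ x′≐y)
  ... | inj₂ ε             = inj₁ x≐x′
  ... | inj₂ (_◅_ {j = z} x′~z walk) = inj₂ (SAdj-respˡ {z = z} x≐x′ x′~z ◅ walk)

  Step-sym : ∀ {x y} → Step x y → Step y x
  Step-sym (adjacent (v , differ , agree)) = adjacent (v , differ ∘ sym , λ w w≢v → sym (agree w w≢v))
  Step-sym (equal x≐y) = equal (pointwise λ v → sym (same x≐y v))

  ⇝ₛ-sym : ∀ {x y} → x ⇝ₛ y → y ⇝ₛ x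
  ⇝ₛ-sym = reverse Step-sym

  exact-if-differ : ∀ {x y} v → proj₁ x v ≢ proj₁ y v → x ⇝ₛ y → Star (SAdj G k) x y
  exact-if-differ v differ walk with exact-or-≐ walk
  ... | inj₁ x≐y = ⊥-elim (differ (same x≐y v))
  ... | inj₂ exact-walk = exact-walk

  detour : (∀ x y → x ⇝ₛ y) → ∀ {x y} v W → x ≐ y → proj₁ x v ≢ proj₁ W v → Star (SAdj G k) x y
  detour connected {x} {y} v W x≐y x≢W =
    exact-if-differ v x≢W (connected x W) ◅◅ exact-if-differ v (λ eq → x≢W (trans (same x≐y v) (sym eq))) (connected W y)

  -- W₁ and W₂ are only needed to join two pointwise equal colourings by a nonempty detour.
  SConnected-if : (∀ x y → x ⇝ₛ y) → (v : Fin n) (W₁ W₂ : SVertex G k) → proj₁ W₁ v ≢ proj₁ W₂ v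
                → SConnected G k
  SConnected-if connected v W₁ W₂ W₁≢W₂ x y with exact-or-≐ (connected x y)
  ... | inj₂ exact-walk = exact-walk
  ... | inj₁ x≐y with proj₁ x v ≟ proj₁ W₁ v
  ...   | yes x≡W₁ = detour connected v W₂ x≐y λ eq → W₁≢W₂ (trans (sym x≡W₁) eq)
  ...   | no  x≢W₁ = detour connected v W₁ x≐y x≢W₁

module Certificate {n : ℕ} (G : Graph n) (G? : ∀ u v → Dec (G u v)) (k : ℕ) where

  open Walks G k

  private
    _≟ᵥ_ : (r s : Vec (Fin k) n) → Dec (r ≡ s)
    _≟ᵥ_ = ≡-dec _≟_

  open import Data.List.Membership.DecPropositional _≟ᵥ_ using (_∈?_)

  -- SAdj G k (c , _) (d , _) unfolds to this, so the check needs no strongness proofs.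
  RecolouredOnce : (c d : Colouring n k) → Set
  RecolouredOnce c d = ∃ λ (v : Fin n) → c v ≢ d v × (∀ w → w ≢ v → c w ≡ d w)

  strong? : ∀ c → Dec (Strong G k c)
  strong? c = (all? λ u → all? λ v → G? u v →-dec ¬? (c u ≟ c v)) ×-dec (all? λ a → any? λ v → c v ≟ a)

  recolouredOnce? : ∀ c d → Dec (RecolouredOnce c d)
  recolouredOnce? c d = any? λ v → ¬? (c v ≟ d v) ×-dec (all? λ w → ¬? (w ≟ v) →-dec c w ≟ d w)

  -- A search tree of S_k(G) from the root, listed in reverse order of discovery.
  Linked : Vec (Fin k) n → List (Vec (Fin k) n) → Set
  Linked root []       = ⊤
  Linked root (r ∷ rs) = Strong G k (lookup r)
                       × (r ≡ root ⊎ Any.Any (λ s → RecolouredOnce (lookup r) (lookup s)) rs)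
                       × Linked root rs

  linked? : ∀ root rs → Dec (Linked root rs)
  linked? root []       = yes _
  linked? root (r ∷ rs) = strong? (lookup r)
                        ×-dec (r ≟ᵥ root ⊎-dec Any.any? (λ s → recolouredOnce? (lookup r) (lookup s)) rs)
                        ×-dec linked? root rs

  Complete : List (Vec (Fin k) n) → Set
  Complete rs = ∀ r → Strong G k (lookup r) → r ∈ rs

  all-vectors? : ∀ {m} {P : Vec (Fin k) m → Set} → (∀ r → Dec (P r)) → Dec (∀ r → P r)
  all-vectors? {zero}  P? = map′ (λ p → λ { [] → p }) (λ all → all []) (P? [])
  all-vectors? {suc m} P? = map′ (λ all → λ { (a ∷ r) → all a r }) (λ all a r → all (a ∷ r))
                              (all? λ a → all-vectors? λ r → P? (a ∷ r))

  complete? : ∀ rs → Dec (Complete rs)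
  complete? rs = all-vectors? λ r → strong? (lookup r) →-dec r ∈? rs

  module _ (root : Vec (Fin k) n) (strong-root : Strong G k (lookup root)) where

    Reaches : Vec (Fin k) n → Set
    Reaches r = Σ (Strong G k (lookup r)) λ s → (lookup r , s) ⇝ₛ (lookup root , strong-root)

    linked-reaches : ∀ rs → Linked root rs → All Reaches rs
    linked-reaches []       _                   = []
    linked-reaches (r ∷ rs) (s , next , linked) = reaches-r next ∷ reaches
      where
      reaches : All Reaches rs
      reaches = linked-reaches rs linked
      reaches-r : r ≡ root ⊎ Any.Any (λ s → RecolouredOnce (lookup r) (lookup s)) rs → Reaches r
      reaches-r (inj₁ refl) = s , equal (pointwise λ _ → refl) ◅ ε
      reaches-r (inj₂ neighbour) with lookupAny reaches neighbour
      ... | (_ , walk) , r~r′ = s , adjacent r~r′ ◅ walk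

    strong-resp : ∀ {c d} → (∀ v → c v ≡ d v) → Strong G k c → Strong G k d
    strong-resp c≗d (proper-c , onto-c) =
      (λ u v uv eq → proper-c u v uv (trans (c≗d u) (trans eq (sym (c≗d v))))) ,
      λ a → map₂ (trans (sym (c≗d _))) (onto-c a)

    certified-connected : ∀ rs → Linked root rs → Complete rs → ∀ x y → x ⇝ₛ y
    certified-connected rs linked complete x y = to-root x ◅◅ ⇝ₛ-sym (to-root y)
      where
      to-root : ∀ x → x ⇝ₛ (lookup root , strong-root)
      to-root (c , s) with All.lookup (linked-reaches rs linked) (complete (tabulate c) (strong-resp (sym ∘ lookup∘tabulate c) s))
      ... | s′ , walk = equal (pointwise λ v → sym (lookup∘tabulate c v)) ◅ walk

path? : ∀ {n} (u v : Fin n) → Dec (Path n u v)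
path? u v = toℕ v ℕ.≟ suc (toℕ u) ⊎-dec toℕ u ℕ.≟ suc (toℕ v)

module _ {n k : ℕ} where

  open Walks (Path n) k

  fromPath : PathColouring n k → SVertex (Path n) k
  fromPath c = colour c ∘ toℕ , proper′ , covers′
    where
    proper′ : Proper (Path n) k (colour c ∘ toℕ)
    proper′ u v (inj₁ v≡u+1) eq = proper c (toℕ u) (subst (_< n) v≡u+1 (toℕ<n v)) (trans eq (cong (colour c) v≡u+1))
    proper′ u v (inj₂ u≡v+1) eq = proper c (toℕ v) (subst (_< n) u≡v+1 (toℕ<n u)) (trans (sym eq) (cong (colour c) u≡v+1))
    covers′ : Surjective (colour c ∘ toℕ)
    covers′ a with covers c a
    ... | i , i<n , ci≡a = fromℕ< i<n , trans (cong (colour c) (toℕ-fromℕ< i<n)) ci≡a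

  fromPath-step : ∀ {c d} → (Adjacent ∪ _≈_) c d → Step (fromPath c) (fromPath d)
  fromPath-step {c} {d} (inj₁ (adjacent v v<n differ same)) =
    adjacent (fromℕ< v<n , (λ eq → differ (subst (λ i → colour c i ≡ colour d i) (toℕ-fromℕ< v<n) eq))
             , λ w w≢v → same (toℕ w) (toℕ<n w) (λ eq → w≢v (toℕ-injective (trans eq (sym (toℕ-fromℕ< v<n))))))
  fromPath-step (inj₂ c≈d) = equal (pointwise λ v → agree c≈d (toℕ v) (toℕ<n v))

  fromPath-⇝ : ∀ {c d} → c ⇝ d → fromPath c ⇝ₛ fromPath d
  fromPath-⇝ = gmap fromPath fromPath-step

module _ {n k : ℕ} .{{_ : NonZero n}} where

  open Walks (Path n) k

  toPath : SVertex (Path n) k → PathColouring n k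
  toPath (c , proper-c , onto-c) = record
    { colour = λ i → c (i mod n)
    ; proper = λ i i+1<n → proper-c (i mod n) (suc i mod n)
                 (inj₁ (trans (toℕ-mod-< i+1<n) (cong suc (sym (toℕ-mod-< (ℕₚ.<-trans (ℕₚ.n<1+n i) i+1<n))))))
    ; covers = λ a → let (v , cv≡a) = onto-c a in toℕ v , toℕ<n v , trans (cong c (toℕ-mod-inverse v)) cv≡a
    }

  toPath-step : ∀ {x y} → Step x y → (Adjacent ∪ _≈_) (toPath x) (toPath y)
  toPath-step {c , _} {d , _} (adjacent (v , differ , same)) =
    inj₁ (adjacent (toℕ v) (toℕ<n v) (λ eq → differ (subst (λ u → c u ≡ d u) (toℕ-mod-inverse v) eq))
           λ w w<n w≢v → same (w mod n) (λ eq → w≢v (trans (sym (toℕ-mod-< w<n)) (cong toℕ eq))))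
  toPath-step (equal x≐y) = inj₂ (agreeing λ i _ → same x≐y (i mod n))

  toPath-⇝ : ∀ {x y} → x ⇝ₛ y → toPath x ⇝ toPath y
  toPath-⇝ = gmap toPath toPath-step

  connected⇒⇝ₛ : Connected n k → ∀ x y → x ⇝ₛ y
  connected⇒⇝ₛ connected x y =
    equal (pointwise λ v → cong (proj₁ x) (sym (toℕ-mod-inverse v)))
    ◅ fromPath-⇝ (connected (toPath x) (toPath y))
    ◅◅ equal (pointwise λ v → cong (proj₁ y) (toℕ-mod-inverse v)) ◅ ε

  ⇝ₛ⇒connected : (∀ x y → x ⇝ₛ y) → Connected n k
  ⇝ₛ⇒connected connected c d =
    ≈⇒⇝ (agreeing λ i i<n → cong (colour c) (sym (toℕ-mod-< i<n)))
    ◅◅ toPath-⇝ (connected (fromPath c) (fromPath d))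
    ◅◅ ≈⇒⇝ (agreeing λ i i<n → cong (colour d) (toℕ-mod-< i<n))

module _ (k : ℕ) .{{_ : NonZero k}} (root : Vec ℕ 5) (rows : List (Vec ℕ 5)) where

  open Certificate (Path 5) path? k

  private
    root′ : Vec (Fin k) 5
    root′ = Vec.map (_mod k) root
    rows′ : List (Vec (Fin k) 5)
    rows′ = List.map (Vec.map (_mod k)) rows

  connected-by-certificate : {_ : True (strong? (lookup root′))} {_ : True (linked? root′ rows′)}
                             {_ : True (complete? rows′)} → Connected 5 k
  connected-by-certificate {s} {l} {c} =
    ⇝ₛ⇒connected (certified-connected root′ (toWitness s) rows′ (toWitness l) (toWitness c))

-- Strong colourings of P₅ in reverse breadth-first order from the cyclic colouring.
certificate₃ : List (Vec ℕ 5)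
certificate₃ =
  (0 ∷ 2 ∷ 0 ∷ 2 ∷ 1 ∷ []) ∷ (0 ∷ 2 ∷ 1 ∷ 2 ∷ 1 ∷ []) ∷ (1 ∷ 2 ∷ 0 ∷ 2 ∷ 1 ∷ []) ∷ (0 ∷ 1 ∷ 0 ∷ 2 ∷ 1 ∷ []) ∷
  (0 ∷ 2 ∷ 1 ∷ 2 ∷ 0 ∷ []) ∷ (0 ∷ 2 ∷ 1 ∷ 0 ∷ 1 ∷ []) ∷ (1 ∷ 2 ∷ 0 ∷ 2 ∷ 0 ∷ []) ∷ (2 ∷ 1 ∷ 0 ∷ 2 ∷ 1 ∷ []) ∷
  (0 ∷ 1 ∷ 0 ∷ 2 ∷ 0 ∷ []) ∷ (1 ∷ 2 ∷ 1 ∷ 2 ∷ 0 ∷ []) ∷ (1 ∷ 2 ∷ 1 ∷ 0 ∷ 1 ∷ []) ∷ (0 ∷ 2 ∷ 1 ∷ 0 ∷ 2 ∷ []) ∷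
  (1 ∷ 2 ∷ 0 ∷ 1 ∷ 0 ∷ []) ∷ (2 ∷ 1 ∷ 0 ∷ 2 ∷ 0 ∷ []) ∷ (1 ∷ 0 ∷ 1 ∷ 2 ∷ 0 ∷ []) ∷ (1 ∷ 0 ∷ 2 ∷ 1 ∷ 0 ∷ []) ∷
  (2 ∷ 0 ∷ 2 ∷ 1 ∷ 2 ∷ []) ∷ (1 ∷ 2 ∷ 1 ∷ 0 ∷ 2 ∷ []) ∷ (2 ∷ 0 ∷ 2 ∷ 1 ∷ 0 ∷ []) ∷ (0 ∷ 2 ∷ 0 ∷ 1 ∷ 0 ∷ []) ∷
  (1 ∷ 2 ∷ 0 ∷ 1 ∷ 2 ∷ []) ∷ (2 ∷ 1 ∷ 0 ∷ 1 ∷ 0 ∷ []) ∷ (2 ∷ 0 ∷ 1 ∷ 2 ∷ 0 ∷ []) ∷ (1 ∷ 0 ∷ 1 ∷ 2 ∷ 1 ∷ []) ∷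
  (1 ∷ 0 ∷ 2 ∷ 1 ∷ 2 ∷ []) ∷ (1 ∷ 0 ∷ 1 ∷ 0 ∷ 2 ∷ []) ∷ (2 ∷ 1 ∷ 2 ∷ 1 ∷ 0 ∷ []) ∷ (0 ∷ 2 ∷ 0 ∷ 1 ∷ 2 ∷ []) ∷
  (2 ∷ 1 ∷ 0 ∷ 1 ∷ 2 ∷ []) ∷ (2 ∷ 0 ∷ 1 ∷ 0 ∷ 2 ∷ []) ∷ (2 ∷ 0 ∷ 1 ∷ 2 ∷ 1 ∷ []) ∷ (1 ∷ 0 ∷ 2 ∷ 0 ∷ 2 ∷ []) ∷
  (0 ∷ 1 ∷ 2 ∷ 1 ∷ 0 ∷ []) ∷ (0 ∷ 1 ∷ 0 ∷ 1 ∷ 2 ∷ []) ∷ (2 ∷ 0 ∷ 1 ∷ 0 ∷ 1 ∷ []) ∷ (1 ∷ 0 ∷ 2 ∷ 0 ∷ 1 ∷ []) ∷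
  (0 ∷ 1 ∷ 2 ∷ 1 ∷ 2 ∷ []) ∷ (2 ∷ 1 ∷ 2 ∷ 0 ∷ 2 ∷ []) ∷ (2 ∷ 0 ∷ 2 ∷ 0 ∷ 1 ∷ []) ∷ (0 ∷ 1 ∷ 2 ∷ 0 ∷ 2 ∷ []) ∷
  (2 ∷ 1 ∷ 2 ∷ 0 ∷ 1 ∷ []) ∷ (0 ∷ 1 ∷ 2 ∷ 0 ∷ 1 ∷ []) ∷
  []

certificate₄ : List (Vec ℕ 5)
certificate₄ =
  (0 ∷ 3 ∷ 2 ∷ 1 ∷ 0 ∷ []) ∷ (0 ∷ 3 ∷ 2 ∷ 1 ∷ 3 ∷ []) ∷ (0 ∷ 3 ∷ 2 ∷ 1 ∷ 2 ∷ []) ∷ (2 ∷ 3 ∷ 2 ∷ 1 ∷ 0 ∷ []) ∷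
  (1 ∷ 3 ∷ 2 ∷ 1 ∷ 0 ∷ []) ∷ (0 ∷ 1 ∷ 2 ∷ 1 ∷ 3 ∷ []) ∷ (0 ∷ 3 ∷ 0 ∷ 1 ∷ 2 ∷ []) ∷ (2 ∷ 3 ∷ 0 ∷ 1 ∷ 2 ∷ []) ∷
  (2 ∷ 3 ∷ 0 ∷ 1 ∷ 0 ∷ []) ∷ (1 ∷ 3 ∷ 2 ∷ 3 ∷ 0 ∷ []) ∷ (0 ∷ 1 ∷ 2 ∷ 0 ∷ 3 ∷ []) ∷ (1 ∷ 3 ∷ 0 ∷ 1 ∷ 2 ∷ []) ∷
  (2 ∷ 3 ∷ 0 ∷ 1 ∷ 3 ∷ []) ∷ (3 ∷ 0 ∷ 2 ∷ 0 ∷ 1 ∷ []) ∷ (1 ∷ 0 ∷ 2 ∷ 3 ∷ 0 ∷ []) ∷ (3 ∷ 1 ∷ 2 ∷ 0 ∷ 3 ∷ []) ∷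
  (3 ∷ 1 ∷ 2 ∷ 0 ∷ 1 ∷ []) ∷ (2 ∷ 1 ∷ 2 ∷ 0 ∷ 3 ∷ []) ∷ (1 ∷ 3 ∷ 0 ∷ 3 ∷ 2 ∷ []) ∷ (2 ∷ 1 ∷ 0 ∷ 1 ∷ 3 ∷ []) ∷
  (1 ∷ 0 ∷ 2 ∷ 3 ∷ 2 ∷ []) ∷ (3 ∷ 0 ∷ 2 ∷ 3 ∷ 1 ∷ []) ∷ (1 ∷ 0 ∷ 2 ∷ 3 ∷ 1 ∷ []) ∷ (3 ∷ 1 ∷ 2 ∷ 0 ∷ 2 ∷ []) ∷
  (2 ∷ 1 ∷ 3 ∷ 0 ∷ 3 ∷ []) ∷ (2 ∷ 1 ∷ 3 ∷ 0 ∷ 1 ∷ []) ∷ (2 ∷ 0 ∷ 3 ∷ 0 ∷ 1 ∷ []) ∷ (1 ∷ 2 ∷ 0 ∷ 3 ∷ 2 ∷ []) ∷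
  (3 ∷ 2 ∷ 0 ∷ 2 ∷ 1 ∷ []) ∷ (2 ∷ 1 ∷ 0 ∷ 2 ∷ 3 ∷ []) ∷ (3 ∷ 0 ∷ 1 ∷ 0 ∷ 2 ∷ []) ∷ (3 ∷ 0 ∷ 1 ∷ 3 ∷ 2 ∷ []) ∷
  (1 ∷ 0 ∷ 1 ∷ 3 ∷ 2 ∷ []) ∷ (2 ∷ 0 ∷ 2 ∷ 3 ∷ 1 ∷ []) ∷ (3 ∷ 1 ∷ 3 ∷ 0 ∷ 2 ∷ []) ∷ (2 ∷ 1 ∷ 3 ∷ 0 ∷ 2 ∷ []) ∷
  (2 ∷ 0 ∷ 3 ∷ 2 ∷ 1 ∷ []) ∷ (3 ∷ 2 ∷ 0 ∷ 3 ∷ 1 ∷ []) ∷ (1 ∷ 2 ∷ 0 ∷ 3 ∷ 1 ∷ []) ∷ (1 ∷ 2 ∷ 0 ∷ 3 ∷ 0 ∷ []) ∷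
  (3 ∷ 1 ∷ 0 ∷ 2 ∷ 3 ∷ []) ∷ (3 ∷ 1 ∷ 0 ∷ 2 ∷ 1 ∷ []) ∷ (0 ∷ 1 ∷ 0 ∷ 2 ∷ 3 ∷ []) ∷ (3 ∷ 2 ∷ 1 ∷ 0 ∷ 2 ∷ []) ∷
  (2 ∷ 0 ∷ 1 ∷ 3 ∷ 2 ∷ []) ∷ (2 ∷ 0 ∷ 1 ∷ 3 ∷ 1 ∷ []) ∷ (0 ∷ 1 ∷ 3 ∷ 0 ∷ 2 ∷ []) ∷ (3 ∷ 0 ∷ 3 ∷ 2 ∷ 1 ∷ []) ∷
  (3 ∷ 2 ∷ 1 ∷ 2 ∷ 0 ∷ []) ∷ (1 ∷ 0 ∷ 3 ∷ 2 ∷ 1 ∷ []) ∷ (0 ∷ 2 ∷ 0 ∷ 3 ∷ 1 ∷ []) ∷ (3 ∷ 2 ∷ 1 ∷ 3 ∷ 0 ∷ []) ∷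
  (1 ∷ 2 ∷ 1 ∷ 3 ∷ 0 ∷ []) ∷ (3 ∷ 1 ∷ 0 ∷ 2 ∷ 0 ∷ []) ∷ (0 ∷ 1 ∷ 3 ∷ 2 ∷ 3 ∷ []) ∷ (0 ∷ 1 ∷ 3 ∷ 2 ∷ 1 ∷ []) ∷
  (3 ∷ 2 ∷ 1 ∷ 0 ∷ 1 ∷ []) ∷ (0 ∷ 2 ∷ 3 ∷ 2 ∷ 1 ∷ []) ∷ (3 ∷ 2 ∷ 1 ∷ 0 ∷ 3 ∷ []) ∷ (2 ∷ 0 ∷ 1 ∷ 3 ∷ 0 ∷ []) ∷
  (1 ∷ 0 ∷ 3 ∷ 2 ∷ 0 ∷ []) ∷ (0 ∷ 1 ∷ 3 ∷ 1 ∷ 2 ∷ []) ∷ (3 ∷ 0 ∷ 1 ∷ 2 ∷ 1 ∷ []) ∷ (3 ∷ 0 ∷ 1 ∷ 2 ∷ 0 ∷ []) ∷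
  (1 ∷ 0 ∷ 3 ∷ 2 ∷ 3 ∷ []) ∷ (0 ∷ 2 ∷ 1 ∷ 3 ∷ 1 ∷ []) ∷ (0 ∷ 2 ∷ 1 ∷ 3 ∷ 0 ∷ []) ∷ (3 ∷ 1 ∷ 3 ∷ 2 ∷ 0 ∷ []) ∷
  (0 ∷ 1 ∷ 3 ∷ 2 ∷ 0 ∷ []) ∷ (1 ∷ 2 ∷ 1 ∷ 0 ∷ 3 ∷ []) ∷ (3 ∷ 2 ∷ 3 ∷ 0 ∷ 1 ∷ []) ∷ (0 ∷ 2 ∷ 3 ∷ 0 ∷ 1 ∷ []) ∷
  (0 ∷ 2 ∷ 1 ∷ 0 ∷ 3 ∷ []) ∷ (2 ∷ 3 ∷ 1 ∷ 3 ∷ 0 ∷ []) ∷ (1 ∷ 2 ∷ 3 ∷ 2 ∷ 0 ∷ []) ∷ (0 ∷ 2 ∷ 3 ∷ 1 ∷ 2 ∷ []) ∷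
  (3 ∷ 0 ∷ 1 ∷ 2 ∷ 3 ∷ []) ∷ (1 ∷ 0 ∷ 1 ∷ 2 ∷ 3 ∷ []) ∷ (0 ∷ 2 ∷ 1 ∷ 3 ∷ 2 ∷ []) ∷ (2 ∷ 1 ∷ 3 ∷ 2 ∷ 0 ∷ []) ∷
  (1 ∷ 2 ∷ 3 ∷ 0 ∷ 3 ∷ []) ∷ (1 ∷ 2 ∷ 3 ∷ 0 ∷ 1 ∷ []) ∷ (0 ∷ 2 ∷ 1 ∷ 2 ∷ 3 ∷ []) ∷ (2 ∷ 3 ∷ 1 ∷ 2 ∷ 0 ∷ []) ∷
  (0 ∷ 2 ∷ 3 ∷ 1 ∷ 3 ∷ []) ∷ (1 ∷ 2 ∷ 3 ∷ 1 ∷ 0 ∷ []) ∷ (0 ∷ 2 ∷ 3 ∷ 1 ∷ 0 ∷ []) ∷ (2 ∷ 0 ∷ 1 ∷ 2 ∷ 3 ∷ []) ∷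
  (0 ∷ 3 ∷ 1 ∷ 3 ∷ 2 ∷ []) ∷ (2 ∷ 1 ∷ 3 ∷ 1 ∷ 0 ∷ []) ∷ (1 ∷ 2 ∷ 3 ∷ 0 ∷ 2 ∷ []) ∷ (1 ∷ 2 ∷ 0 ∷ 2 ∷ 3 ∷ []) ∷
  (1 ∷ 3 ∷ 1 ∷ 2 ∷ 0 ∷ []) ∷ (0 ∷ 3 ∷ 1 ∷ 2 ∷ 3 ∷ []) ∷ (0 ∷ 3 ∷ 1 ∷ 2 ∷ 0 ∷ []) ∷ (1 ∷ 2 ∷ 0 ∷ 1 ∷ 3 ∷ []) ∷
  (0 ∷ 2 ∷ 0 ∷ 1 ∷ 3 ∷ []) ∷ (3 ∷ 2 ∷ 3 ∷ 1 ∷ 0 ∷ []) ∷ (2 ∷ 0 ∷ 1 ∷ 0 ∷ 3 ∷ []) ∷ (0 ∷ 3 ∷ 1 ∷ 0 ∷ 2 ∷ []) ∷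
  (2 ∷ 0 ∷ 3 ∷ 1 ∷ 0 ∷ []) ∷ (1 ∷ 0 ∷ 3 ∷ 0 ∷ 2 ∷ []) ∷ (1 ∷ 3 ∷ 0 ∷ 2 ∷ 3 ∷ []) ∷ (1 ∷ 3 ∷ 0 ∷ 2 ∷ 0 ∷ []) ∷
  (0 ∷ 3 ∷ 1 ∷ 2 ∷ 1 ∷ []) ∷ (3 ∷ 2 ∷ 0 ∷ 1 ∷ 3 ∷ []) ∷ (3 ∷ 2 ∷ 0 ∷ 1 ∷ 0 ∷ []) ∷ (2 ∷ 3 ∷ 1 ∷ 0 ∷ 3 ∷ []) ∷
  (2 ∷ 3 ∷ 1 ∷ 0 ∷ 2 ∷ []) ∷ (1 ∷ 3 ∷ 1 ∷ 0 ∷ 2 ∷ []) ∷ (2 ∷ 0 ∷ 3 ∷ 1 ∷ 3 ∷ []) ∷ (1 ∷ 0 ∷ 2 ∷ 0 ∷ 3 ∷ []) ∷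
  (2 ∷ 0 ∷ 3 ∷ 1 ∷ 2 ∷ []) ∷ (1 ∷ 0 ∷ 3 ∷ 1 ∷ 2 ∷ []) ∷ (1 ∷ 3 ∷ 0 ∷ 2 ∷ 1 ∷ []) ∷ (0 ∷ 3 ∷ 0 ∷ 2 ∷ 1 ∷ []) ∷
  (3 ∷ 2 ∷ 0 ∷ 1 ∷ 2 ∷ []) ∷ (2 ∷ 3 ∷ 1 ∷ 0 ∷ 1 ∷ []) ∷ (1 ∷ 3 ∷ 2 ∷ 0 ∷ 3 ∷ []) ∷ (1 ∷ 3 ∷ 2 ∷ 0 ∷ 2 ∷ []) ∷
  (2 ∷ 0 ∷ 2 ∷ 1 ∷ 3 ∷ []) ∷ (1 ∷ 0 ∷ 2 ∷ 1 ∷ 3 ∷ []) ∷ (3 ∷ 0 ∷ 3 ∷ 1 ∷ 2 ∷ []) ∷ (2 ∷ 3 ∷ 0 ∷ 2 ∷ 1 ∷ []) ∷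
  (3 ∷ 1 ∷ 0 ∷ 1 ∷ 2 ∷ []) ∷ (2 ∷ 3 ∷ 2 ∷ 0 ∷ 1 ∷ []) ∷ (1 ∷ 3 ∷ 2 ∷ 0 ∷ 1 ∷ []) ∷ (3 ∷ 0 ∷ 2 ∷ 1 ∷ 3 ∷ []) ∷
  (3 ∷ 0 ∷ 2 ∷ 1 ∷ 2 ∷ []) ∷ (2 ∷ 3 ∷ 0 ∷ 3 ∷ 1 ∷ []) ∷ (3 ∷ 1 ∷ 0 ∷ 3 ∷ 2 ∷ []) ∷ (0 ∷ 3 ∷ 2 ∷ 0 ∷ 1 ∷ []) ∷
  (3 ∷ 0 ∷ 2 ∷ 1 ∷ 0 ∷ []) ∷ (2 ∷ 1 ∷ 0 ∷ 3 ∷ 2 ∷ []) ∷ (2 ∷ 1 ∷ 0 ∷ 3 ∷ 1 ∷ []) ∷ (0 ∷ 1 ∷ 0 ∷ 3 ∷ 2 ∷ []) ∷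
  (0 ∷ 3 ∷ 2 ∷ 3 ∷ 1 ∷ []) ∷ (3 ∷ 1 ∷ 2 ∷ 1 ∷ 0 ∷ []) ∷ (2 ∷ 1 ∷ 0 ∷ 3 ∷ 0 ∷ []) ∷ (0 ∷ 1 ∷ 2 ∷ 3 ∷ 2 ∷ []) ∷
  (0 ∷ 1 ∷ 2 ∷ 3 ∷ 1 ∷ []) ∷ (3 ∷ 1 ∷ 2 ∷ 3 ∷ 0 ∷ []) ∷ (2 ∷ 1 ∷ 2 ∷ 3 ∷ 0 ∷ []) ∷ (0 ∷ 1 ∷ 2 ∷ 3 ∷ 0 ∷ []) ∷
  []

connected-5-3 : Connected 5 3
connected-5-3 = connected-by-certificate 3 (0 ∷ 1 ∷ 2 ∷ 0 ∷ 1 ∷ []) certificate₃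

connected-5-4 : Connected 5 4
connected-5-4 = connected-by-certificate 4 (0 ∷ 1 ∷ 2 ∷ 3 ∷ 0 ∷ []) certificate₄

-- Sufficiency

connected-paths : ∀ {n k} → 3 ≤ k → k < n → 5 ≤ n → Connected n k
connected-paths (s≤s (s≤s (s≤s z≤n))) k<n 5≤n with ℕₚ.m≤n⇒m<n∨m≡n 5≤n
connected-paths {k = 3} _ _ _ | inj₂ refl = connected-5-3
connected-paths {k = 4} _ _ _ | inj₂ refl = connected-5-4
connected-paths {k = suc (suc (suc (suc (suc _))))} _ (s≤s (s≤s (s≤s (s≤s (s≤s ()))))) _ | inj₂ refl
connected-paths {suc m} {3} _ 3<n _ | inj₁ 5<n =
  lift-connected ℕₚ.≤-refl (connected-paths ℕₚ.≤-refl 3<m 5≤m) (covers-below-3 (ℕₚ.<⇒≤ 3<m))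
  where
  5≤m : 5 ≤ m
  5≤m = ℕₚ.≤-pred 5<n
  3<m : 3 < m
  3<m = ℕₚ.<-≤-trans (s≤s (s≤s (s≤s (s≤s z≤n)))) 5≤m
connected-paths {suc m} {suc (suc (suc (suc k)))} _ k<n _ | inj₁ 5<n =
  extend-connected (s≤s (s≤s z≤n)) (ℕₚ.≤-pred k<n)
    (connected-paths (s≤s (s≤s (s≤s z≤n))) (ℕₚ.≤-pred k<n) (ℕₚ.≤-pred 5<n))

SConnected-path : ∀ {n k} → 3 ≤ k → k < n → 5 ≤ n → SConnected (Path n) k
SConnected-path {suc n} {suc k} 3≤k@(s≤s 2≤k) k<n 5≤n@(s≤s _) =
  Walks.SConnected-if (Path (suc n)) (suc k) (connected⇒⇝ₛ (connected-paths 3≤k k<n 5≤n))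
    zero (fromPath (cyclic 1≤k k<n+1)) (fromPath (shifted 1≤k k<n+1)) (mod-suc-≢ 1≤k 0)
  where
  1≤k : 1 ≤ k
  1≤k = ℕₚ.<⇒≤ 2≤k
  k<n+1 : k < suc n
  k<n+1 = ℕₚ.<⇒≤ k<n

-- Necessity

module _ {n : ℕ} {G : Graph n} {k : ℕ} {A : Set} (f : SVertex G k → A)
         (invariant : ∀ x y → SAdj G k x y → f x ≡ f y) where

  walk-invariant : ∀ {x y} → Star (SAdj G k) x y → f x ≡ f y
  walk-invariant ε = refl
  walk-invariant (_◅_ {i = x} {j = y} x~y walk) = trans (invariant x y x~y) (walk-invariant walk)

  disconnected : ∀ x y → f x ≢ f y → ¬ SConnected G k
  disconnected x y fx≢fy connected = fx≢fy (walk-invariant (connected x y))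

neighbour : ∀ {n} (v : Fin (suc (suc n))) → ∃ λ w → w ≢ v × Path (suc (suc n)) v w
neighbour zero    = suc zero , (λ ()) , inj₁ refl
neighbour (suc v) = Fin.inject₁ v , (λ eq → ℕₚ.1+n≢n (trans (cong toℕ (sym eq)) (toℕ-inject₁ v)))
                  , inj₂ (cong suc (sym (toℕ-inject₁ v)))

-- With two colours every vertex is forced by its neighbour, so no recolouring is proper.
no-recolouring₂ : ∀ {n} (x y : SVertex (Path (suc (suc n))) 2) → ¬ SAdj (Path (suc (suc n))) 2 x y
no-recolouring₂ (c , proper-c , _) (d , proper-d , _) (v , cv≢dv , same) with neighbour v
... | w , w≢v , v~w =
  cv≢dv (avoiding-one-unique₂ (c w) (c v) (d v) (proper-c v w v~w) λ eq → proper-d v w v~w (trans eq (same w w≢v)))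

last-colour-new : ∀ c → Strong (Path 4) 3 c → c zero ≡ c (suc (suc zero)) → c (suc (suc (suc zero))) ≢ c (suc zero)
last-colour-new c (proper-c , onto) c₀≡c₂ c₃≡c₁ with fresh₂ ℕₚ.≤-refl (c zero) (c (suc zero))
... | t , t≢c₀ , t≢c₁ with onto t
...   | zero , c₀≡t                 = t≢c₀ (sym c₀≡t)
...   | suc zero , c₁≡t             = t≢c₁ (sym c₁≡t)
...   | suc (suc zero) , c₂≡t       = t≢c₀ (sym (trans c₀≡c₂ c₂≡t))
...   | suc (suc (suc zero)) , c₃≡t = t≢c₁ (trans (sym c₃≡t) c₃≡c₁)

-- If vertex 1 changed from b to b′, vertices 0 and 2 would both carry the third colour, and each colouring
-- would need its own missing colour, b′ resp. b, at vertex 3.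
vertex-1-frozen : ∀ x y → SAdj (Path 4) 3 x y → proj₁ x (suc zero) ≡ proj₁ y (suc zero)
vertex-1-frozen (c , sc@(proper-c , _)) (d , sd@(proper-d , _)) (v , cv≢dv , same) with v Fin.≟ suc zero
... | no  v≢1 = same (suc zero) (v≢1 ∘ sym)
... | yes refl = ⊥-elim (c₃≢d₁ c₃≡d₁)
  where
  v₀ v₁ v₂ v₃ : Fin 4
  v₀ = zero
  v₁ = suc zero
  v₂ = suc (suc zero)
  v₃ = suc (suc (suc zero))
  c₀≢c₁ : c v₀ ≢ c v₁
  c₀≢c₁ = proper-c v₀ v₁ (inj₁ refl)
  c₂≢c₁ : c v₂ ≢ c v₁
  c₂≢c₁ = proper-c v₁ v₂ (inj₁ refl) ∘ sym
  d₁≢c₀ : d v₁ ≢ c v₀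
  d₁≢c₀ eq = proper-d v₀ v₁ (inj₁ refl) (trans (sym (same v₀ (λ ()))) (sym eq))
  d₁≢c₂ : d v₁ ≢ c v₂
  d₁≢c₂ eq = proper-d v₁ v₂ (inj₁ refl) (trans eq (same v₂ (λ ())))
  c₀≡c₂ : c v₀ ≡ c v₂
  c₀≡c₂ = avoiding-two-unique₃ (c v₁) (d v₁) (c v₀) (c v₂) cv≢dv c₀≢c₁ (d₁≢c₀ ∘ sym) c₂≢c₁ (d₁≢c₂ ∘ sym)
  c₃≢d₁ : c v₃ ≢ d v₁
  c₃≢d₁ eq = last-colour-new d sd (trans (sym (same v₀ (λ ()))) (trans c₀≡c₂ (same v₂ (λ ()))))
               (trans (sym (same v₃ (λ ()))) eq)
  c₃≡d₁ : c v₃ ≡ d v₁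
  c₃≡d₁ = avoiding-two-unique₃ (c v₀) (c v₁) (c v₃) (d v₁) c₀≢c₁
            (λ eq → proper-c v₂ v₃ (inj₁ refl) (trans (sym c₀≡c₂) (sym eq))) (last-colour-new c sc c₀≡c₂)
            d₁≢c₀ (cv≢dv ∘ sym)

two-colours : ∀ {χ} (a b : Fin χ) → a ≢ b → 2 ≤ χ
two-colours {suc zero}    zero zero a≢b = ⊥-elim (a≢b refl)
two-colours {suc (suc χ)} _    _    _   = s≤s (s≤s z≤n)

S₂-disconnected : ∀ {n} → ¬ SConnected (Path (suc (suc n))) 2
S₂-disconnected {n} = disconnected (λ x → proj₁ x zero) (λ x y x~y → ⊥-elim (no-recolouring₂ x y x~y))
  (fromPath (cyclic ℕₚ.≤-refl (s≤s (s≤s z≤n)))) (fromPath (shifted ℕₚ.≤-refl (s≤s (s≤s z≤n))))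
  (mod-suc-≢ ℕₚ.≤-refl 0)

S₃P₄-disconnected : ¬ SConnected (Path 4) 3
S₃P₄-disconnected = disconnected (λ x → proj₁ x (suc zero)) vertex-1-frozen
  (fromPath (cyclic (s≤s z≤n) (ℕₚ.n≤1+n 3))) (fromPath (shifted (s≤s z≤n) (ℕₚ.n≤1+n 3))) (mod-suc-≢ (s≤s z≤n) 1)

at-least-three-colours : ∀ {n k} → 1 ≤ k → (∃ λ χ → IsChromaticNumber (Path n) χ × χ ≤ k) → k < n
                       → SConnected (Path n) k → 3 ≤ k
at-least-three-colours {k = 1} _ (χ , ((c , proper-c) , _) , χ≤1) (s≤s (s≤s _)) _ =
  ⊥-elim (ℕₚ.<-irrefl refl (ℕₚ.<-≤-trans (two-colours (c zero) (c (suc zero)) (proper-c zero (suc zero) (inj₁ refl))) χ≤1))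
at-least-three-colours {k = 2} _ _ (s≤s (s≤s (s≤s _))) connected = ⊥-elim (S₂-disconnected connected)
at-least-three-colours {k = suc (suc (suc k))} _ _ _ _ = s≤s (s≤s (s≤s z≤n))

at-least-five-vertices : ∀ {n k} → 3 ≤ k → k < n → SConnected (Path n) k → 5 ≤ n
at-least-five-vertices 3≤k k<n connected with ℕₚ.m≤n⇒m<n∨m≡n (ℕₚ.≤-trans (s≤s 3≤k) k<n)
... | inj₁ 4<n  = 4<n
... | inj₂ refl with ℕₚ.≤-antisym (ℕₚ.≤-pred k<n) 3≤k
...   | refl = ⊥-elim (S₃P₄-disconnected connected)

theorem3p3 : (n k : ℕ) → 1 ≤ k →
    (∃ λ χ → IsChromaticNumber (Path n) χ × χ ≤ k) →
    suc k ≤ n →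
    SConnected (Path n) k ⇔ (3 ≤ k × 5 ≤ n × suc k ≤ n)
theorem3p3 n k 1≤k chromatic k<n = mk⇔ necessary (λ (3≤k , 5≤n , _) → SConnected-path 3≤k k<n 5≤n)
  where
  necessary : SConnected (Path n) k → 3 ≤ k × 5 ≤ n × suc k ≤ n
  necessary connected = 3≤k , at-least-five-vertices 3≤k k<n connected , k<n
    where
    3≤k : 3 ≤ k
    3≤k = at-least-three-colours 1≤k chromatic k<n connected
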